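{- Let $\mathcal P$ be a schedule with events $e_1<\dots<e_q$, partition $(\xi_1,\dots,\xi_{q-1})$ and abnormality point $i\ne\infty$. Then for each job $a\in\mathcal J$ and each integer $i'$ with $1\le i'\le i$, the number $\sum_{j=i'}^{q-1}\xi_j(a)$ is $i'$-normal.
   Context: Scheduling setting. $\mathcal{J}$ is a finite set of jobs, each with processing time $1$ and a nonnegative integer release date; they are scheduled preemptively on two identical processors subject to release dates and in-tree precedence constraints. The events of a schedule $\mathcal P$ are $0=e_1<\dots<e_q$, the set of $0$ together with all job start and completion times. Block $i$ is the part of $\mathcal P$ in $[e_i,e_{i+1}]$; $\xi_i(a)$ is the amount of job $a$ processed in block $i$. A real $x\ge0$ is $l$-normal if $x=l'/2^l$ for an integer $l'$. Block $i$ is $l$-normal if $e_{i+1}-e_i$ is $l$-normal and $\xi_i(a)$ is $(l+1)$-normal for every job $a$. The abnormality point of a non-normal schedule is the least $i$ such that block $i$ is not $i$-normal; it is $\infty$ if every block $i$ is $i$-normal.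
   Formalization: Schedules have rational event times and rational amounts $\xi_i(a)$ instead of real ones. -}

module Defs where

open import Data.Nat as ℕ using (ℕ; zero; suc; _^_; _∸_)
open import Data.Nat.Properties using (m^n≢0)
open import Data.Integer using (ℤ; +_)
open import Data.Rational using (ℚ; _/_; 0ℚ; 1ℚ; _+_; _-_; _*_; _≤_; _<_)
open import Data.Fin using (Fin)
open import Data.List using (List; map; foldr; upTo; allFin)
open import Data.Maybe using (Maybe; just)
open import Data.Product using (Σ; ∃; _×_)
open import Data.Sum using (_⊎_)
open import Relation.Nullary using (¬_)
open import Relation.Binary.PropositionalEquality using (_≡_)
open import Relation.Binary.Construct.Closure.Transitive using (TransClosure)

Normal : ℕ → ℚ → Set
Normal l x = (0ℚ ≤ x) × ∃ λ (l' : ℤ) → x ≡ _/_ l' (2 ^ l) {{m^n≢0 2 l}}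

sumℚ : List ℚ → ℚ
sumℚ = foldr _+_ 0ℚ

-- Σ_{j=a}^{b} f j  (empty, i.e. 0, if b < a)
sumRange : (ℕ → ℚ) → ℕ → ℕ → ℚ
sumRange f a b = sumℚ (map (λ k → f (a ℕ.+ k)) (upTo (suc b ∸ a)))

sumJobs : ∀ {n} → (Fin n → ℚ) → ℚ
sumJobs {n} g = sumℚ (map g (allFin n))

-- Instances: jobs are Fin n, unit processing times, integer release
-- dates, in-tree precedence given by an (optional) immediate successor.

record Instance : Set where
  field
    n       : ℕ
    release : Fin n → ℕ
    succ    : Fin n → Maybe (Fin n)
  Imm : Fin n → Fin n → Set
  Imm a b = succ a ≡ just b
  field
    acyclic : ∀ a → ¬ TransClosure Imm a a

-- A preemptive two-processor schedule, described (as in the paper) by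
-- its events e 1 < … < e q and its partition ξ 1 , … , ξ (q-1).
-- Indices are 1-based as in the paper; values of e, ξ outside the
-- ranges 1..q resp. 1..q-1 are irrelevant.

module _ (I : Instance) where
  open Instance I

  rel : Fin n → ℚ
  rel a = + release a / 1

  -- e k is the start time of job a: a is processed in block k and in
  -- no earlier block
  IsStart : (q : ℕ) (ξ : ℕ → Fin n → ℚ) → Fin n → ℕ → Set
  IsStart q ξ a k = (k ℕ.< q) × (0ℚ < ξ k a) ×
                    (∀ j → 1 ℕ.≤ j → j ℕ.< k → ξ j a ≡ 0ℚ)

  -- e k is the completion time of job a: a is processed in block k-1
  -- and in no later block
  IsCompletion : (q : ℕ) (ξ : ℕ → Fin n → ℚ) → Fin n → ℕ → Set
  IsCompletion q ξ a k = (2 ℕ.≤ k) × (k ℕ.≤ q) × (0ℚ < ξ (k ∸ 1) a) ×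
                         (∀ j → k ℕ.≤ j → j ℕ.< q → ξ j a ≡ 0ℚ)

  record IsSchedule (q : ℕ) (e : ℕ → ℚ) (ξ : ℕ → Fin n → ℚ) : Set where
    field
      q≥1        : 1 ℕ.≤ q
      e-first    : e 1 ≡ 0ℚ
      e-increase : ∀ j → 1 ℕ.≤ j → j ℕ.< q → e j < e (suc j)
      -- amounts are nonnegative; a job runs on at most one processor
      ξ-nonneg   : ∀ j a → 1 ℕ.≤ j → j ℕ.< q → 0ℚ ≤ ξ j a
      ξ-one-proc : ∀ j a → 1 ℕ.≤ j → j ℕ.< q → ξ j a ≤ e (suc j) - e j
      ξ-two-proc : ∀ j → 1 ℕ.≤ j → j ℕ.< q →
                   sumJobs (ξ j) ≤ (1ℚ + 1ℚ) * (e (suc j) - e j)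
      ξ-complete : ∀ a → sumRange (λ j → ξ j a) 1 (q ∸ 1) ≡ 1ℚ
      ξ-release  : ∀ j a → 1 ℕ.≤ j → j ℕ.< q → 0ℚ < ξ j a → rel a ≤ e j
      ξ-prec     : ∀ a b → Imm a b → ∀ j → 1 ℕ.≤ j → j ℕ.< q → 0ℚ < ξ j b →
                   sumRange (λ k → ξ k a) 1 (j ∸ 1) ≡ 1ℚ
      e-events   : ∀ k → 2 ℕ.≤ k → k ℕ.≤ q →
                   ∃ λ a → IsStart q ξ a k ⊎ IsCompletion q ξ a k


module _ {n : ℕ} (e : ℕ → ℚ) (ξ : ℕ → Fin n → ℚ) where

  -- block k (the part in [e k , e (k+1)]) is l-normal
  BlockNormal : ℕ → ℕ → Set
  BlockNormal l k = Normal l (e (suc k) - e k) × (∀ a → Normal (suc l) (ξ k a))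

  AbnormalityPoint : (q i : ℕ) → Set
  AbnormalityPoint q i = (1 ℕ.≤ i) × (i ℕ.< q) × ¬ BlockNormal i i ×
                         (∀ k → 1 ℕ.≤ k → k ℕ.< i → BlockNormal k k)

-- The total amount of job a is 1, and the amount processed in a block j < i' is
-- (j+1)-normal, hence i'-normal, because block j is j-normal (j lies before the
-- abnormality point).  Dyadic rationals with denominator 2^i' are closed under
-- sums and negation, so the tail sum, being 1 minus the head sum, is i'-normal.
module Submission where

open import Defs
open import Data.Nat as ℕ using (ℕ; zero; suc; _^_; _∸_; _≤_; _<_; _≤′_; ≤′-refl; ≤′-step; z≤n; s≤s)
open import Data.Nat.Properties using (m^n≢0; ≤⇒≤′; ≤-pred; ≤-trans; <⇒≤; <-≤-trans; +-monoʳ-<; m+[n∸m]≡n)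
open import Data.Fin using (Fin)
open import Data.List using (applyUpTo)
open import Data.List.Properties using (map-upTo; foldr-preservesᵇ)
open import Data.List.Relation.Unary.All.Properties using (applyUpTo⁺₁)
open import Data.Product using (∃; _,_; proj₂)
open import Data.Integer as ℤ using (ℤ; +_)
import Data.Integer.Properties as ℤ
open import Data.Rational using (ℚ; _/_; 0ℚ; 1ℚ; _+_; -_; toℚᵘ) renaming (_≤_ to _≤ℚ_)
open import Data.Rational.Properties
  using ( +-identityˡ; +-assoc; +-mono-≤; ≤-refl; 0/n≡0; +-0-group
        ; fromℚᵘ-cong; toℚᵘ-injective; toℚᵘ-fromℚᵘ; toℚᵘ-homo-+; toℚᵘ-homo‿-)
import Data.Rational.Unnormalised as ℚᵘ
import Data.Rational.Unnormalised.Properties as ℚᵘ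
open import Algebra.Properties.Group +-0-group using (y≈x\\z)
open import Relation.Binary.PropositionalEquality

/-≡-cross : ∀ z w d e .{{_ : ℕ.NonZero d}} .{{_ : ℕ.NonZero e}} →
            z ℤ.* + e ≡ w ℤ.* + d → z / d ≡ w / e
/-≡-cross z w (suc d) (suc e) eq = fromℚᵘ-cong {ℚᵘ.mkℚᵘ z d} {ℚᵘ.mkℚᵘ w e} (ℚᵘ.*≡* eq)

/-distribʳ-+ : ∀ z w d .{{_ : ℕ.NonZero d}} → (z ℤ.+ w) / d ≡ z / d + w / d
/-distribʳ-+ z w d@(suc d-1) = toℚᵘ-injective homo
  where
  D : ℤ
  D = + d

  cross : (z ℤ.+ w) ℤ.* + (d ℕ.* d) ≡ (z ℤ.* D ℤ.+ w ℤ.* D) ℤ.* D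
  cross = begin
    (z ℤ.+ w) ℤ.* + (d ℕ.* d)      ≡⟨ cong ((z ℤ.+ w) ℤ.*_) (ℤ.pos-* d d) ⟩
    (z ℤ.+ w) ℤ.* (D ℤ.* D)        ≡⟨ ℤ.*-assoc (z ℤ.+ w) D D ⟨
    (z ℤ.+ w) ℤ.* D ℤ.* D          ≡⟨ cong (ℤ._* D) (ℤ.*-distribʳ-+ D z w) ⟩
    (z ℤ.* D ℤ.+ w ℤ.* D) ℤ.* D    ∎
    where open ≡-Reasoning

  homo : toℚᵘ ((z ℤ.+ w) / d) ℚᵘ.≃ toℚᵘ (z / d + w / d)
  homo = begin
    toℚᵘ ((z ℤ.+ w) / d)             ≈⟨ toℚᵘ-fromℚᵘ (ℚᵘ.mkℚᵘ (z ℤ.+ w) d-1) ⟩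
    ℚᵘ.mkℚᵘ (z ℤ.+ w) d-1            ≈⟨ ℚᵘ.*≡* cross ⟩
    ℚᵘ.mkℚᵘ z d-1 ℚᵘ.+ ℚᵘ.mkℚᵘ w d-1 ≈⟨ ℚᵘ.+-cong (toℚᵘ-fromℚᵘ (ℚᵘ.mkℚᵘ z d-1))
                                                   (toℚᵘ-fromℚᵘ (ℚᵘ.mkℚᵘ w d-1)) ⟨
    toℚᵘ (z / d) ℚᵘ.+ toℚᵘ (w / d)   ≈⟨ toℚᵘ-homo-+ (z / d) (w / d) ⟨
    toℚᵘ (z / d + w / d)             ∎
    where open ℚᵘ.≃-Reasoning

neg-/ : ∀ z d .{{_ : ℕ.NonZero d}} → (ℤ.- z) / d ≡ - (z / d)
neg-/ z d@(suc d-1) = toℚᵘ-injective (begin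
  toℚᵘ ((ℤ.- z) / d)          ≈⟨ toℚᵘ-fromℚᵘ (ℚᵘ.mkℚᵘ (ℤ.- z) d-1) ⟩
  ℚᵘ.- ℚᵘ.mkℚᵘ z d-1          ≈⟨ ℚᵘ.-‿cong (toℚᵘ-fromℚᵘ (ℚᵘ.mkℚᵘ z d-1)) ⟨
  ℚᵘ.- toℚᵘ (z / d)           ≈⟨ toℚᵘ-homo‿- (z / d) ⟨
  toℚᵘ (- (z / d))            ∎)
  where open ℚᵘ.≃-Reasoning

Dyadic : ℕ → ℚ → Set
Dyadic l x = ∃ λ (z : ℤ) → x ≡ _/_ z (2 ^ l) {{m^n≢0 2 l}}

Dyadic-0 : ∀ l → Dyadic l 0ℚ
Dyadic-0 l = + 0 , sym (0/n≡0 (2 ^ l) {{m^n≢0 2 l}})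

Dyadic-1 : ∀ l → Dyadic l 1ℚ
Dyadic-1 l = + (2 ^ l) , /-≡-cross (+ 1) (+ (2 ^ l)) 1 (2 ^ l) {{_}} {{m^n≢0 2 l}}
  (trans (ℤ.*-identityˡ (+ (2 ^ l))) (sym (ℤ.*-identityʳ (+ (2 ^ l)))))

Dyadic-+ : ∀ l {x y} → Dyadic l x → Dyadic l y → Dyadic l (x + y)
Dyadic-+ l (z , refl) (w , refl) = z ℤ.+ w , sym (/-distribʳ-+ z w (2 ^ l) {{m^n≢0 2 l}})

Dyadic-neg : ∀ l {x} → Dyadic l x → Dyadic l (- x)
Dyadic-neg l (z , refl) = ℤ.- z , sym (neg-/ z (2 ^ l) {{m^n≢0 2 l}})

Dyadic-suc : ∀ l {x} → Dyadic l x → Dyadic (suc l) x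
Dyadic-suc l (z , refl) = z ℤ.* + 2 ,
  /-≡-cross z (z ℤ.* + 2) (2 ^ l) (2 ^ suc l) {{m^n≢0 2 l}} {{m^n≢0 2 (suc l)}}
    (trans (cong (z ℤ.*_) (ℤ.pos-* 2 (2 ^ l))) (sym (ℤ.*-assoc z (+ 2) (+ (2 ^ l)))))

Dyadic-mono : ∀ {l m x} → l ≤ m → Dyadic l x → Dyadic m x
Dyadic-mono l≤m = go (≤⇒≤′ l≤m)
  where
  go : ∀ {l m x} → l ≤′ m → Dyadic l x → Dyadic m x
  go ≤′-refl              d = d
  go (≤′-step {m} l≤′m) d = Dyadic-suc m (go l≤′m d)

sumUpTo : (ℕ → ℚ) → ℕ → ℚ
sumUpTo h n = sumℚ (applyUpTo h n)

sumRange≡sumUpTo : ∀ f a b → sumRange f a b ≡ sumUpTo (λ k → f (a ℕ.+ k)) (suc b ∸ a)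
sumRange≡sumUpTo f a b = cong sumℚ (map-upTo (λ k → f (a ℕ.+ k)) (suc b ∸ a))

sumUpTo-+ : ∀ h m n → sumUpTo h (m ℕ.+ n) ≡ sumUpTo h m + sumUpTo (λ k → h (m ℕ.+ k)) n
sumUpTo-+ h zero    n = sym (+-identityˡ _)
sumUpTo-+ h (suc m) n = trans (cong (λ t → h 0 + t) (sumUpTo-+ (λ k → h (suc k)) m n))
                              (sym (+-assoc (h 0) _ _))

sumUpTo-preserves : (P : ℚ → Set) → (∀ {x y} → P x → P y → P (x + y)) → P 0ℚ →
                    ∀ h n → (∀ {k} → k < n → P (h k)) → P (sumUpTo h n)
sumUpTo-preserves P P-+ P-0 h n Ph = foldr-preservesᵇ {P = P} P-+ P-0 (applyUpTo⁺₁ h n Ph)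

lemma11 : (I : Instance) (q : ℕ) (e : ℕ → ℚ) (ξ : ℕ → Fin (Instance.n I) → ℚ) →
          IsSchedule I q e ξ →
          (i : ℕ) → AbnormalityPoint e ξ q i →
          (a : Fin (Instance.n I)) (i' : ℕ) → 1 ≤ i' → i' ≤ i →
          Normal i' (sumRange (λ j → ξ j a) i' (q ∸ 1))
lemma11 I zero     e ξ sch i (_ , () , _) a i' _ _
lemma11 I (suc q') e ξ sch i (_ , i<q , _ , normal-below) a (suc p) _ i'≤i =
  tail-nonneg ,
  subst (Dyadic (suc p)) (sym tail≡-head+1)
        (Dyadic-+ (suc p) (Dyadic-neg (suc p) head-dyadic) (Dyadic-1 (suc p)))
  where
  open IsSchedule sch

  f : ℕ → ℚ
  f j = ξ j a

  head tail : ℚ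
  head = sumUpTo (λ k → f (suc k)) p
  tail = sumRange f (suc p) q'

  p≤q' : p ≤ q'
  p≤q' = ≤-pred (≤-trans i'≤i (<⇒≤ i<q))

  total : head + tail ≡ 1ℚ
  total = begin
    head + tail                                     ≡⟨ cong (_+_ head) (sumRange≡sumUpTo f (suc p) q') ⟩
    head + sumUpTo (λ k → f (suc p ℕ.+ k)) (q' ∸ p) ≡⟨ sumUpTo-+ (λ k → f (suc k)) p (q' ∸ p) ⟨
    sumUpTo (λ k → f (suc k)) (p ℕ.+ (q' ∸ p))      ≡⟨ cong (sumUpTo (λ k → f (suc k))) (m+[n∸m]≡n p≤q') ⟩
    sumUpTo (λ k → f (suc k)) q'                    ≡⟨ sumRange≡sumUpTo f 1 q' ⟨
    sumRange f 1 q'                                 ≡⟨ ξ-complete a ⟩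
    1ℚ                                              ∎
    where open ≡-Reasoning

  tail≡-head+1 : tail ≡ - head + 1ℚ
  tail≡-head+1 = y≈x\\z head tail 1ℚ total

  head-dyadic : Dyadic (suc p) head
  head-dyadic = sumUpTo-preserves (Dyadic (suc p)) (Dyadic-+ (suc p)) (Dyadic-0 (suc p)) _ p
    λ {k} k<p → Dyadic-mono (s≤s k<p)
      (proj₂ (proj₂ (normal-below (suc k) (s≤s z≤n) (<-≤-trans (s≤s k<p) i'≤i)) a))

  tail-nonneg : 0ℚ ≤ℚ tail
  tail-nonneg = subst (0ℚ ≤ℚ_) (sym (sumRange≡sumUpTo f (suc p) q'))
    (sumUpTo-preserves (0ℚ ≤ℚ_) +-mono-≤ ≤-refl _ (q' ∸ p)
      λ {k} k<q'∸p → ξ-nonneg (suc p ℕ.+ k) a (s≤s z≤n)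
        (s≤s (subst (p ℕ.+ k <_) (m+[n∸m]≡n p≤q') (+-monoʳ-< p k<q'∸p))))
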